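{- The theory $COMI_{fcn}+WPRA$ proves the existence of binary functions $+$, $\cdot$, $-$ and unary functions $sg$, $\overline{sg}$, $odd$, $f'$, $P$ (written in infix notation where customary) such that, writing $1$ for $S(0)$: (i) $m+0=m\wedge(\forall n)(m+S(n)=S(m+n))$; (ii) $m\cdot0=0\wedge(\forall n)(m\cdot S(n)=m\cdot n+m)$; (iii) $sg(0)=0\wedge(\forall n)(sg(S(n))=1)$; (iv) $\overline{sg}(0)=1\wedge(\forall n)(\overline{sg}(S(n))=0)$; (v) $odd(0)=0\wedge(\forall n)(odd(S(n))=\overline{sg}(odd(n)))$; (vi) $f'(0)=0\wedge(\forall n)(f'(S(n))=\overline{sg}(f'(n))+f'(n)\cdot S(f'(n)))$; (vii) $P(0)=0\wedge(\forall n)(P(S(n))=\overline{sg}(odd(f'(S(n))))\cdot S(P(n)))$; (viii) $m-0=m\wedge(\forall n)(m-S(n)=P(m-n))$; all holding for all numbers $m,n$.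
   Context: The language $L_{fcn}$ is four-sorted: number variables ranging over $\omega$; function variables of arity 1, 2, 3 ranging over unary, binary, ternary functions on $\omega$; a constant $0$ and unary function symbol $S$ (successor). Terms are number variables, $0$, $S(t)$, and $f(t)$, $f(t,q)$, $f(t,q,r)$ for function variables of the corresponding arity; atomic formulas are equations of terms; formulas use connectives and quantifiers over numbers and functions of each arity. Free variables in axioms are read universally. $COMI_{fcn}$ consists of: (1) Successor axioms: $S(n)\neq 0$; $S(n)=S(m)\rightarrow n=m$; $n\neq 0\rightarrow(\exists m)(S(m)=n)$. (2) Initial function axioms: $(\exists f)(\forall m)(f(m)=n)$ ($f$ unary); ternary projections $(\exists f)(\forall m,n,r)(f(m,n,r)=m)$, and likewise with $=n$, $=r$; $(\exists f)(\forall n)(f(n)=S(n))$. (3) Composition axioms: (i) $(\exists f)(\forall m,n,r)(f(m,n,r)=g(m,n))$; (ii) $(\exists f)(\forall m,n,r)(f(m,n,r)=g(m))$; (iii) $(\exists f)(\forall m,n)(f(m,n)=g(m,n,r))$; (iv) $(\exists f)(\forall m)(f(m)=g(m,n,r))$; (v) $(\exists f)(\forall m,n,r)(f(m,n,r)=g(h_1(m,n,r),h_2(m,n,r),h_3(m,n,r)))$. (6) Rudimentary induction: for unary $f,g$: $f(0)=g(0)\wedge(\forall n)(f(n)=g(n)\rightarrow f(S(n))=g(S(n)))\rightarrow f(n)=g(n)$. $WPRA$: for unary $g$ and ternary $h$, $(\exists f)(\forall m)(f(m,0)=g(m)\wedge(\forall n)(f(m,S(n))=h(m,S(n),f(m,n))))$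 with $f$ binary. The symbols $+,\cdot,-,sg,\overline{sg},odd,f',P$ are just names for function variables (existentially quantified), not new symbols of the language. -}

module Defs where

open import Data.Product using (Σ; _×_; _,_)
open import Relation.Binary.PropositionalEquality using (_≡_)
open import Relation.Nullary using (¬_)

-- A (Henkin) structure for the four-sorted language L_fcn:
-- a number domain N with 0 and S, and three function sorts whose
-- elements are applied to numbers via ap1, ap2, ap3.
record Structure : Set₁ where
  field
    N   : Set
    O   : N
    S   : N → N
    F1  : Set
    F2  : Set
    F3  : Set
    ap1 : F1 → N → N
    ap2 : F2 → N → N → N
    ap3 : F3 → N → N → N → N

module _ (M : Structure) where
  open Structure M

  record COMI : Set where
    field
      S≢0     : ∀ n → ¬ (S n ≡ O)
      S-inj   : ∀ n m → S n ≡ S m → n ≡ m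
      pred∃   : ∀ n → ¬ (n ≡ O) → Σ N λ m → S m ≡ n
      const∃  : ∀ n → Σ F1 λ f → ∀ m → ap1 f m ≡ n
      proj₁∃  : Σ F3 λ f → ∀ m n r → ap3 f m n r ≡ m
      proj₂∃  : Σ F3 λ f → ∀ m n r → ap3 f m n r ≡ n
      proj₃∃  : Σ F3 λ f → ∀ m n r → ap3 f m n r ≡ r
      succ∃   : Σ F1 λ f → ∀ n → ap1 f n ≡ S n
      comp-i   : ∀ g → Σ F3 λ f → ∀ m n r → ap3 f m n r ≡ ap2 g m n
      comp-ii  : ∀ g → Σ F3 λ f → ∀ m n r → ap3 f m n r ≡ ap1 g m
      comp-iii : ∀ g r → Σ F2 λ f → ∀ m n → ap2 f m n ≡ ap3 g m n r
      comp-iv  : ∀ g n r → Σ F1 λ f → ∀ m → ap1 f m ≡ ap3 g m n r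
      comp-v   : ∀ g h₁ h₂ h₃ → Σ F3 λ f → ∀ m n r →
                   ap3 f m n r ≡ ap3 g (ap3 h₁ m n r) (ap3 h₂ m n r) (ap3 h₃ m n r)
      rud-ind  : ∀ f g n → ap1 f O ≡ ap1 g O →
                   (∀ k → ap1 f k ≡ ap1 g k → ap1 f (S k) ≡ ap1 g (S k)) →
                   ap1 f n ≡ ap1 g n

  WPRA : Set
  WPRA = ∀ (g : F1) (h : F3) → Σ F2 λ f → ∀ m →
           (ap2 f m O ≡ ap1 g m) × (∀ n → ap2 f m (S n) ≡ ap3 h m (S n) (ap2 f m n))

  record Lemma5Functions : Set where
    field
      plus times minus : F2
      sg sgbar odd f' P : F1
    one : N
    one = S O
    _+_ : N → N → N
    _+_ = ap2 plus
    _·_ : N → N → N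
    _·_ = ap2 times
    _-_ : N → N → N
    _-_ = ap2 minus
    field
      i-0    : ∀ m → m + O ≡ m
      i-S    : ∀ m n → m + S n ≡ S (m + n)
      ii-0   : ∀ m → m · O ≡ O
      ii-S   : ∀ m n → m · S n ≡ (m · n) + m
      iii-0  : ap1 sg O ≡ O
      iii-S  : ∀ n → ap1 sg (S n) ≡ one
      iv-0   : ap1 sgbar O ≡ one
      iv-S   : ∀ n → ap1 sgbar (S n) ≡ O
      v-0    : ap1 odd O ≡ O
      v-S    : ∀ n → ap1 odd (S n) ≡ ap1 sgbar (ap1 odd n)
      vi-0   : ap1 f' O ≡ O
      vi-S   : ∀ n → ap1 f' (S n) ≡
                 ap1 sgbar (ap1 f' n) + (ap1 f' n · S (ap1 f' n))
      vii-0  : ap1 P O ≡ O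
      vii-S  : ∀ n → ap1 P (S n) ≡
                 ap1 sgbar (ap1 odd (ap1 f' (S n))) · S (ap1 P n)
      viii-0 : ∀ m → m - O ≡ m
      viii-S : ∀ m n → m - S n ≡ ap1 P (m - n)

{-# OPTIONS --safe #-}
module Submission where

-- Every function obtained from numbers, S and function variables by
-- substitution is represented by a ternary function: the projection and
-- constant axioms give the atoms and axiom (3v) closes them under
-- composition, while (3i)/(3ii) pad unary and binary functions to arity
-- three and (3iii)/(3iv) cut ternary ones back down. WPRA then yields
-- each of +, ·, -, sg, sḡ, odd, f', P from its recursion equations; a
-- unary recursion is the parameter-0 section of a binary one.

open import Defs
open import Data.Product using (Σ; _,_; proj₁; proj₂)
open import Relation.Binary.PropositionalEquality
  using (_≡_; refl; sym; trans; cong; module ≡-Reasoning)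

module Definability (M : Structure) (C : COMI M) where
  open Structure M
  open COMI C

  Definable₁ : (N → N) → Set
  Definable₁ φ = Σ F1 λ f → ∀ m → ap1 f m ≡ φ m

  Definable₃ : (N → N → N → N) → Set
  Definable₃ φ = Σ F3 λ f → ∀ m n r → ap3 f m n r ≡ φ m n r

  definable-resp : {φ ψ : N → N → N → N} → (∀ m n r → φ m n r ≡ ψ m n r) →
                   Definable₃ φ → Definable₃ ψ
  definable-resp φ≡ψ (f , f≡φ) = f , λ m n r → trans (f≡φ m n r) (φ≡ψ m n r)

  definable-π₁ : Definable₃ λ m n r → m
  definable-π₁ = proj₁∃

  definable-π₂ : Definable₃ λ m n r → n
  definable-π₂ = proj₂∃

  definable-π₃ : Definable₃ λ m n r → r
  definable-π₃ = proj₃∃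

  definable-const : (c : N) → Definable₃ λ m n r → c
  definable-const c with const∃ c
  ... | g , g≡c with comp-ii g
  ...   | f , f≡g = f , λ m n r → trans (f≡g m n r) (g≡c m)

  definable-ap₃ : {φ ψ χ : N → N → N → N} (g : F3) →
                  Definable₃ φ → Definable₃ ψ → Definable₃ χ →
                  Definable₃ λ m n r → ap3 g (φ m n r) (ψ m n r) (χ m n r)
  definable-ap₃ g (h₁ , h₁≡φ) (h₂ , h₂≡ψ) (h₃ , h₃≡χ) with comp-v g h₁ h₂ h₃
  ... | f , f≡g∘h = f , λ m n r →
          trans (f≡g∘h m n r) (cong-ap3 (h₁≡φ m n r) (h₂≡ψ m n r) (h₃≡χ m n r))
    where
    cong-ap3 : ∀ {a a′ b b′ c c′} → a ≡ a′ → b ≡ b′ → c ≡ c′ → ap3 g a b c ≡ ap3 g a′ b′ c′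
    cong-ap3 refl refl refl = refl

  definable-ap₁ : {φ : N → N → N → N} (g : F1) →
                  Definable₃ φ → Definable₃ λ m n r → ap1 g (φ m n r)
  definable-ap₁ g φ-def with comp-ii g
  ... | G , G≡g = definable-resp (λ m n r → G≡g _ _ _) (definable-ap₃ G φ-def φ-def φ-def)

  definable-ap₂ : {φ ψ : N → N → N → N} (g : F2) →
                  Definable₃ φ → Definable₃ ψ → Definable₃ λ m n r → ap2 g (φ m n r) (ψ m n r)
  definable-ap₂ g φ-def ψ-def with comp-i g
  ... | G , G≡g = definable-resp (λ m n r → G≡g _ _ _) (definable-ap₃ G φ-def ψ-def ψ-def)

  definable-S : {φ : N → N → N → N} → Definable₃ φ → Definable₃ λ m n r → S (φ m n r)
  definable-S φ-def with succ∃
  ... | s , s≡S = definable-resp (λ m n r → s≡S _) (definable-ap₁ s φ-def)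

  definable₁-section : {φ : N → N → N → N} → Definable₃ φ → Definable₁ λ m → φ m O O
  definable₁-section (g , g≡φ) with comp-iv g O O
  ... | f , f≡g = f , λ m → trans (f≡g m) (g≡φ m O O)

module Recursion (M : Structure) (C : COMI M) (W : WPRA M) where
  open Structure M
  open Definability M C

  record Recursion₂ (γ : N → N) (η : N → N → N → N) : Set where
    field
      fun  : F2
      at-0 : ∀ m → ap2 fun m O ≡ γ m
      at-S : ∀ m n → ap2 fun m (S n) ≡ η m (S n) (ap2 fun m n)

  record Recursion₁ (c : N) (η : N → N → N) : Set where
    field
      fun  : F1
      at-0 : ap1 fun O ≡ c
      at-S : ∀ n → ap1 fun (S n) ≡ η (S n) (ap1 fun n)

  open Recursion₂
  open Recursion₁

  recursion₂ : {γ : N → N} {η : N → N → N → N} →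
               Definable₁ γ → Definable₃ η → Recursion₂ γ η
  recursion₂ (g , g≡γ) (h , h≡η) with W g h
  ... | f , f-eqs = record
    { fun  = f
    ; at-0 = λ m → trans (proj₁ (f-eqs m)) (g≡γ m)
    ; at-S = λ m n → trans (proj₂ (f-eqs m) n) (h≡η m (S n) (ap2 f m n))
    }

  recursion₁ : {η : N → N → N} (c : N) → Definable₃ (λ _ n r → η n r) → Recursion₁ c η
  recursion₁ {η} c η-def = record { fun = u ; at-0 = u-at-0 ; at-S = u-at-S }
    where
    F : Recursion₂ (λ _ → c) (λ _ n r → η n r)
    F = recursion₂ (definable₁-section (definable-const c)) η-def

    section : Definable₁ λ n → ap2 (fun F) O n
    section = definable₁-section (definable-ap₂ (fun F) (definable-const O) definable-π₁)

    u : F1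
    u = proj₁ section

    u-at-0 : ap1 u O ≡ c
    u-at-0 = trans (proj₂ section O) (at-0 F O)

    u-at-S : ∀ n → ap1 u (S n) ≡ η (S n) (ap1 u n)
    u-at-S n = begin
      ap1 u (S n)                  ≡⟨ proj₂ section (S n) ⟩
      ap2 (fun F) O (S n)          ≡⟨ at-S F O n ⟩
      η (S n) (ap2 (fun F) O n)    ≡⟨ cong (η (S n)) (sym (proj₂ section n)) ⟩
      η (S n) (ap1 u n)            ∎
      where open ≡-Reasoning

module Arithmetic (M : Structure) (C : COMI M) (W : WPRA M) where
  open Structure M
  open Definability M C
  open Recursion M C W
  open Recursion₂
  open Recursion₁

  addition : Recursion₂ (λ m → m) (λ _ _ r → S r)
  addition = recursion₂ (definable₁-section definable-π₁) (definable-S definable-π₃)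

  multiplication : Recursion₂ (λ _ → O) (λ m _ r → ap2 (fun addition) r m)
  multiplication = recursion₂ (definable₁-section (definable-const O))
                     (definable-ap₂ (fun addition) definable-π₃ definable-π₁)

  signum : Recursion₁ O (λ _ _ → S O)
  signum = recursion₁ O (definable-const (S O))

  co-signum : Recursion₁ (S O) (λ _ _ → O)
  co-signum = recursion₁ (S O) (definable-const O)

  parity : Recursion₁ O (λ _ r → ap1 (fun co-signum) r)
  parity = recursion₁ O (definable-ap₁ (fun co-signum) definable-π₃)

  f′ : Recursion₁ O (λ _ r → ap2 (fun addition) (ap1 (fun co-signum) r)
                                (ap2 (fun multiplication) r (S r)))
  f′ = recursion₁ O (definable-ap₂ (fun addition) (definable-ap₁ (fun co-signum) definable-π₃)
                      (definable-ap₂ (fun multiplication) definable-π₃ (definable-S definable-π₃)))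

  predecessor : Recursion₁ O (λ n r → ap2 (fun multiplication)
                                     (ap1 (fun co-signum) (ap1 (fun parity) (ap1 (fun f′) n))) (S r))
  predecessor = recursion₁ O (definable-ap₂ (fun multiplication)
                  (definable-ap₁ (fun co-signum) (definable-ap₁ (fun parity)
                    (definable-ap₁ (fun f′) definable-π₂)))
                  (definable-S definable-π₃))

  subtraction : Recursion₂ (λ m → m) (λ _ _ r → ap1 (fun predecessor) r)
  subtraction = recursion₂ (definable₁-section definable-π₁)
                  (definable-ap₁ (fun predecessor) definable-π₃)

lemma5 : (M : Structure) → COMI M → WPRA M → Lemma5Functions M
lemma5 M C W = record
  { plus   = fun addition       ; i-0    = at-0 addition       ; i-S    = at-S addition
  ; times  = fun multiplication ; ii-0   = at-0 multiplication ; ii-S   = at-S multiplication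
  ; sg     = fun signum         ; iii-0  = at-0 signum         ; iii-S  = at-S signum
  ; sgbar  = fun co-signum      ; iv-0   = at-0 co-signum      ; iv-S   = at-S co-signum
  ; odd    = fun parity         ; v-0    = at-0 parity         ; v-S    = at-S parity
  ; f'     = fun f′             ; vi-0   = at-0 f′             ; vi-S   = at-S f′
  ; P      = fun predecessor    ; vii-0  = at-0 predecessor    ; vii-S  = at-S predecessor
  ; minus  = fun subtraction    ; viii-0 = at-0 subtraction    ; viii-S = at-S subtraction
  }
  where
  open Arithmetic M C W
  open Recursion M C W
  open Recursion₂
  open Recursion₁
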